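{- Let $U$, $L$, $T$, $P_{\sum}$, $\pi'_{\Omega}$, $P^{*}_T$ and $P^{**}_T$ be as described in the context, and let $P_T$ be a program in $L$ computing a total function (i.e. $U(P_T\circ w)$ halts, with a natural-number output, for every $w\in L$). Then for every $w\in L$, $U(P^{**}_T\circ P_T\circ w)$ is a well-defined value (the computation halts); that is, $w\mapsto U(P^{**}_T\circ P_T\circ w)$ is a total function, and hence $U_{P^{**}_T\circ P_T}$ is a Turing submachine (a total Turing machine).
   Context: $U$ is a universal Turing machine whose programming language $L$ is binary, self-delimiting (prefix-free), recursive, and recursively functionalizable: there is a computable operation $(P,w)\mapsto P\circ w\in L$ such that $U(P\circ w)$ equals the result of running program $P$ on input $w$, it is decidable whether a string has the form $P\circ w$ (and $P$, $w$ can then be recovered), and likewise for iterated concatenations $P\circ w_1\circ\dots\circ w_k$ (program $P$ receiving inputs $w_1,\dots,w_k$). Moreover there are constants $\epsilon, C, C'$ such that for all $P,w_1,\dots,w_k$: $|w_i|<|P\circ w_1\circ\dots\circ w_k|$, $|P\circ w_1\circ\dots\circ w_k|\le Ck+|P|+|w_1|+\dots+|w_k|$, and $H(N)\le C'+\log_2 N+(1+\epsilon)\log_2\log_2 N$, where $H(N)$ is the length of a shortest $L$-program that outputs (a representation of) $N$. A natural number $N$ given as input denotes its representation in $L$. All finite bit strings are computably enumerated as $l_1=0,l_2,l_3,\dots$. $T$ is a program with $U(T\circ p)$ = number of steps $U$ takes to run $p$ (undefined if $U(p)$ does not halt). For a program $Q$ computing a total function (a time bound), the Turing submachine $U_Q$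 is defined by: $U_Q(w)=l_1$ if $U(w)$ does not halt within $U(Q\circ w)$ steps, and $U_Q(w)=l_{k+1}$ if $U(w)$ halts within $U(Q\circ w)$ steps with $U(w)=l_k$. $P_{\sum}$: given $Q\circ N$, $U(P_{\sum}\circ Q\circ N)$ is the (finite binary) sum $\sum 2^{ -|p|}$ over programs $p\in L$ with $|p|\le N$ that halt within $U(Q\circ p)$ steps (i.e. $U_Q(p)\ne l_1$); it is $0$ if $N=0$. (It is undefined if $Q$ is not total.) $\pi'_{\Omega}$: on input $Q\circ 0^{|\rho|}1\circ\rho$, where $\rho$ is a finite bit string read as a binary real in $[0,1]$: if $\rho=0$ it returns $0$; otherwise for $n=1,2,\dots$ it computes the sum of $2^{ -|p|}$ over programs $p$ of size $\le n$ halting within time $U(Q\circ p)$, until reaching the first $k$ with this sum $\ge\rho$ (never halting if there is none), then returns $1+$ the largest output of $U_Q$ on programs of size $\le k$. $P^{*}_T$: given inputs $Q$, $P_T$, $w$, it returns $U(T\circ w)$ if (i) $w$ is of the form $\pi'_{\Omega}\circ Q\circ 0^{|\rho|}1\circ\rho$ for some $\rho$, and $U(P_{\sum}\circ Q\circ(|\pi'_{\Omega}\circ Q\circ 0^{|\rho|}1\circ\rho|-1))\ge\rho$, and $U(T\circ w)>U(P_T\circ w)$; otherwise (ii) it returns $U(P_T\circ w)$. $P^{**}_T$: a self-referential program which, given $P_T$ and $w$, reads itself, $P_T$ and $w$, assembles $P^{*}_T\circ P^{**}_T\circ P_T\circ P_T\circ w$ and returns its value; i.e. $U(P^{**}_T\circ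 P_T\circ w)=U(P^{*}_T\circ P^{**}_T\circ P_T\circ P_T\circ w)$ (so in the definition of $P^{*}_T$ the role of $Q$ is played by $P^{**}_T\circ P_T$). -}

module Defs where

open import Data.Bool using (Bool; true; false; if_then_else_)
open import Data.Nat using (ℕ; zero; suc; _≤_; _<_; _⊔_; _∸_)
open import Data.List using (List; []; _∷_; _++_; length; map; concatMap; filterᵇ; upTo; foldr; replicate)
open import Data.Maybe using (Maybe; just; nothing; is-just)
open import Data.Product using (Σ; ∃; _×_; _,_)
open import Data.Sum using (_⊎_)
open import Relation.Nullary using (¬_; Dec)
open import Relation.Binary.PropositionalEquality using (_≡_)
open import Data.Rational as ℚ using (ℚ; 0ℚ; 1ℚ; ½)

Bits : Set
Bits = List Bool

-- Abstract model of the universal machine U and its programming language L.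
-- run t p ≡ just v  means: U, started on p, halts within t steps with output v.
record Machine : Set where
  infixl 20 _∘_
  field
    run        : ℕ → Bits → Maybe Bits
    run-mono   : ∀ t p v → run t p ≡ just v → run (suc t) p ≡ just v
    inL        : Bits → Bool
    prefixFree : ∀ p r → inL p ≡ true → inL (p ++ r) ≡ true → r ≡ []
    _∘_        : Bits → Bits → Bits
    ∘-inL      : ∀ P w → inL P ≡ true → inL (P ∘ w) ≡ true
    ∘-injective : ∀ P w P′ w′ → P ∘ w ≡ P′ ∘ w′ → (P ≡ P′) × (w ≡ w′)
    ∘-split    : ∀ s → Dec (Σ Bits λ P → Σ Bits λ w → s ≡ P ∘ w)
    ∘-length   : ∀ P w → length w < length (P ∘ w)
    num        : ℕ → Bits
    num-injective : ∀ m n → num m ≡ num n → m ≡ n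
    qRep       : ℚ → Bits
    qRep-injective : ∀ x y → qRep x ≡ qRep y → x ≡ y
    -- computable enumeration of all bit strings: l_k = enum (k ∸ 1), l₁ = 0
    enum       : ℕ → Bits
    index      : Bits → ℕ
    enum-index : ∀ v → enum (index v) ≡ v
    index-enum : ∀ n → index (enum n) ≡ n
    enum-zero  : enum 0 ≡ false ∷ []

half^ : ℕ → ℚ
half^ zero    = 1ℚ
half^ (suc k) = ½ ℚ.* half^ k

bitsValFrom : ℕ → Bits → ℚ
bitsValFrom k []           = 0ℚ
bitsValFrom k (b ∷ bs) = (if b then half^ k else 0ℚ) ℚ.+ bitsValFrom (suc k) bs

bitsVal : Bits → ℚ
bitsVal = bitsValFrom 1

code : Bits → Bits
code ρ = replicate (length ρ) false ++ (true ∷ ρ)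

bitsOfLen : ℕ → List Bits
bitsOfLen zero    = [] ∷ []
bitsOfLen (suc n) = concatMap (λ s → (false ∷ s) ∷ (true ∷ s) ∷ []) (bitsOfLen n)

bitsUpTo : ℕ → List Bits
bitsUpTo n = concatMap bitsOfLen (upTo (suc n))

module _ (M : Machine) where
  open Machine M

  _⇓_ : Bits → Bits → Set
  p ⇓ v = Σ ℕ λ t → run t p ≡ just v

  Halts : Bits → Set
  Halts p = Σ Bits λ v → p ⇓ v

  StepsExactly : Bits → ℕ → Set
  StepsExactly p t = (is-just (run t p) ≡ true) × (∀ s → s < t → run s p ≡ nothing)

  Total : Bits → Set
  Total Q = ∀ w → inL w ≡ true → Σ ℕ λ n → (Q ∘ w) ⇓ num n

  progsUpTo : ℕ → List Bits
  progsUpTo n = filterᵇ inL (bitsUpTo n)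

  -- Given time bounds τ p = U(Q ∘ p):
  -- p halts within its time bound
  haltsWithin : (Bits → ℕ) → Bits → Bool
  haltsWithin τ p = is-just (run (τ p) p)

  haltSum : (Bits → ℕ) → ℕ → ℚ
  haltSum τ n = foldr ℚ._+_ 0ℚ (map (λ p → half^ (length p)) (filterᵇ (haltsWithin τ) (progsUpTo n)))

  -- (1-based) index j of the output l_j = U_Q(p) of the Turing submachine U_Q
  UQindex : (Bits → ℕ) → Bits → ℕ
  UQindex τ p with run (τ p) p
  ... | nothing = 1
  ... | just v  = suc (suc (index v))

  -- largest output of U_Q on programs of size ≤ k (as an index; 0 if none)
  maxUQ : (Bits → ℕ) → ℕ → ℕ
  maxUQ τ k = foldr _⊔_ 0 (map (UQindex τ) (progsUpTo k))

  BoundsUpTo : Bits → ℕ → (Bits → ℕ) → Set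
  BoundsUpTo Q n τ = ∀ p → inL p ≡ true → length p ≤ n → (Q ∘ p) ⇓ num (τ p)

  Iff : Set → Set → Set
  Iff A B = (A → B) × (B → A)

  TSpec : Bits → Set
  TSpec T = ∀ p v → Iff ((T ∘ p) ⇓ v) (Σ ℕ λ t → StepsExactly p t × (v ≡ num t))

  PsumSpec : Bits → Set
  PsumSpec Psum = ∀ Q N v → Iff ((Psum ∘ Q ∘ num N) ⇓ v)
    ( ((N ≡ 0) × (v ≡ qRep 0ℚ))
    ⊎ ((1 ≤ N) × Σ (Bits → ℕ) λ τ → BoundsUpTo Q N τ × (v ≡ qRep (haltSum τ N)) ) )

  PiSpec : Bits → Set
  PiSpec πΩ = ∀ Q ρ v → Iff ((πΩ ∘ Q ∘ code ρ) ⇓ v)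
    ( ((bitsVal ρ ≡ 0ℚ) × (v ≡ num 0))
    ⊎ ((¬ (bitsVal ρ ≡ 0ℚ)) × Σ ℕ λ k → (1 ≤ k) × Σ (Bits → ℕ) λ τ →
         BoundsUpTo Q k τ
         × (bitsVal ρ ℚ.≤ haltSum τ k)
         × (∀ n → 1 ≤ n → n < k → haltSum τ n ℚ.< bitsVal ρ)
         × (v ≡ num (suc (maxUQ τ k)))) )

  PStarSpec : (T Psum πΩ PStar : Bits) → Set
  PStarSpec T Psum πΩ PStar = ∀ Q PT w v → Iff ((PStar ∘ Q ∘ PT ∘ w) ⇓ v)
    ( ( (¬ (Σ Bits λ ρ → w ≡ πΩ ∘ Q ∘ code ρ)) × (PT ∘ w) ⇓ v )
    ⊎ ( Σ Bits λ ρ → (w ≡ πΩ ∘ Q ∘ code ρ) × Σ ℚ λ s →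
          ((Psum ∘ Q ∘ num (length w ∸ 1)) ⇓ qRep s)
          × ( ((s ℚ.< bitsVal ρ) × (PT ∘ w) ⇓ v)
            ⊎ ((bitsVal ρ ℚ.≤ s) × Σ ℕ λ a → Σ ℕ λ b →
                 ((T ∘ w) ⇓ num a) × ((PT ∘ w) ⇓ num b)
                 × ( ((b < a) × (v ≡ num a)) ⊎ ((a ≤ b) × (v ≡ num b)) ) ) ) ) )

  PStarStarSpec : (PStar PStarStar : Bits) → Set
  PStarStarSpec PStar PSS = ∀ PT w v →
    Iff ((PSS ∘ PT ∘ w) ⇓ v) ((PStar ∘ (PSS ∘ PT) ∘ PT ∘ w) ⇓ v)

module Submission where

-- We show by strong induction on |w| that U(Q ∘ w) halts with a numeric output
-- for every program w ∈ L.  Unfolding P**_T, the value U(Q ∘ w) is that of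
-- P*_T on (Q, P_T, w).  If w is not an input πΩ ∘ Q ∘ 0^{|ρ|}1ρ, or if the sum
-- computed by P_∑ stays below ρ, P*_T returns U(P_T ∘ w), which exists since
-- P_T is total.  Otherwise P_∑ and πΩ only consult Q on programs of size
-- ≤ |w| − 1 < |w|, where Q is total by induction; hence U(P_∑ ∘ …) halts, and
-- because its value reaches ρ the search of πΩ stops, so w itself halts.  Then
-- T counts the steps of w, and P*_T returns the larger of U(T ∘ w), U(P_T ∘ w).

open import Defs
open import Data.Bool using (true; false)
open import Data.Bool.Properties using () renaming (_≟_ to _≟ᵇ_)
open import Data.Nat using (ℕ; zero; suc; _≤_; _<_; _∸_; z≤n; s≤s)
open import Data.Nat.Properties
  using (≤-refl; ≤-trans; <⇒≤; <-≤-trans; ≮⇒≥; _<?_; _≤?_; ∸-monoˡ-≤; anyUpTo?)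
open import Data.Nat.Induction using (<-wellFounded)
open import Data.List using ([]; _∷_; _++_; length; replicate)
open import Data.List.Properties using (≡-dec)
open import Data.Maybe using (Maybe; just; nothing; is-just)
open import Data.Product using (Σ; _×_; _,_; proj₁; proj₂)
open import Data.Sum using (inj₁; inj₂)
open import Induction.WellFounded using (Acc; acc)
open import Relation.Nullary using (¬_; Dec; yes; no)
open import Relation.Nullary.Decidable using (_×-dec_)
open import Relation.Binary.PropositionalEquality using (_≡_; refl; sym; trans; cong)
open import Data.Rational as ℚ using (ℚ; 0ℚ)
import Data.Rational.Properties as ℚ

module _ {P : ℕ → Set} (P? : ∀ n → Dec (P n)) where

  minimise : ∀ m → P m → Σ ℕ λ k → k ≤ m × P k × (∀ n → n < k → ¬ P n)
  minimise m = go m (<-wellFounded m)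
    where
    go : ∀ m → Acc _<_ m → P m → Σ ℕ λ k → k ≤ m × P k × (∀ n → n < k → ¬ P n)
    go m (acc smaller) Pm with anyUpTo? P? m
    ... | no noneBelow = m , ≤-refl , Pm , λ n n<m Pn → noneBelow (n , n<m , Pn)
    ... | yes (n , n<m , Pn) with go n (smaller n<m) Pn
    ...   | k , k≤n , Pk , least = k , ≤-trans k≤n (<⇒≤ n<m) , Pk , least

decode : Bits → Bits
decode []          = []
decode (false ∷ c) = decode c
decode (true ∷ ρ)  = ρ

decode-code : ∀ ρ → decode (code ρ) ≡ ρ
decode-code ρ = skipZeros (length ρ)
  where
  skipZeros : ∀ n → decode (replicate n false ++ true ∷ ρ) ≡ ρ
  skipZeros zero    = refl
  skipZeros (suc n) = skipZeros n

-- Being a code is decidable: c is a code iff it is the code of decode c.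
code? : ∀ c → Dec (Σ Bits λ ρ → c ≡ code ρ)
code? c with ≡-dec _≟ᵇ_ c (code (decode c))
... | yes c≡ = yes (decode c , c≡)
... | no c≢  = no λ { (ρ , refl) → c≢ (cong code (sym (decode-code ρ))) }

code-nonempty : ∀ ρ → 1 ≤ length (code ρ)
code-nonempty ρ with length ρ
... | zero  = s≤s z≤n
... | suc _ = s≤s z≤n

≤∸1⇒< : ∀ {m n} → 1 ≤ n → m ≤ n ∸ 1 → m < n
≤∸1⇒< {n = suc _} _ m≤n = s≤s m≤n

not-just⇒nothing : ∀ {A : Set} (x : Maybe A) → ¬ (is-just x ≡ true) → x ≡ nothing
not-just⇒nothing nothing  _       = refl
not-just⇒nothing (just _) notJust with notJust refl
... | ()

module _ (M : Machine) where
  open Machine M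

  infix 4 _⇓ᴹ_
  _⇓ᴹ_ : Bits → Bits → Set
  p ⇓ᴹ v = _⇓_ M p v

  NumOut : Bits → Bits → Set
  NumOut Q w = Σ ℕ λ n → Q ∘ w ⇓ᴹ num n

  halts⇒steps : ∀ {p v} → p ⇓ᴹ v → Σ ℕ (StepsExactly M p)
  halts⇒steps {p} (t , ran) with minimise (λ s → is-just (run s p) ≟ᵇ true) t (cong is-just ran)
  ... | k , _ , halted , notYet = k , halted , λ s s<k → not-just⇒nothing (run s p) (notYet s s<k)

  ∘code? : ∀ P w → Dec (Σ Bits λ ρ → w ≡ P ∘ code ρ)
  ∘code? P w with ∘-split w
  ... | no notComposite = no λ { (ρ , w≡) → notComposite (_ , _ , w≡) }
  ... | yes (P′ , c , w≡) with ≡-dec _≟ᵇ_ P′ P | code? c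
  ...   | no P′≢P       | _              = no λ { (ρ , w≡′) → P′≢P (proj₁ (∘-injective _ _ _ _ (trans (sym w≡) w≡′))) }
  ...   | yes refl      | no notCode     = no λ { (ρ , w≡′) → notCode (ρ , proj₂ (∘-injective _ _ _ _ (trans (sym w≡) w≡′))) }
  ...   | yes refl      | yes (ρ , refl) = yes (ρ , w≡)

  choose-bounds : ∀ Q n → (∀ p → inL p ≡ true → length p ≤ n → NumOut Q p)
                → Σ (Bits → ℕ) (BoundsUpTo M Q n)
  choose-bounds Q n out = τ , λ p ip lp → pick-sound p ip lp (inL p ≟ᵇ true) (length p ≤? n)
    where
    pick : ∀ p → Dec (inL p ≡ true) → Dec (length p ≤ n) → ℕ
    pick p (yes ip) (yes lp) = proj₁ (out p ip lp)
    pick p _        _        = 0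

    τ : Bits → ℕ
    τ p = pick p (inL p ≟ᵇ true) (length p ≤? n)

    pick-sound : ∀ p → inL p ≡ true → length p ≤ n
               → (d : Dec (inL p ≡ true)) (e : Dec (length p ≤ n)) → Q ∘ p ⇓ᴹ num (pick p d e)
    pick-sound p _  _  (yes ip) (yes lp) = proj₂ (out p ip lp)
    pick-sound p ip _  (no ¬ip) _        with ¬ip ip
    ... | ()
    pick-sound p _  lp (yes _)  (no ¬lp) with ¬lp lp
    ... | ()

  bounds-mono : ∀ {Q k n τ} → k ≤ n → BoundsUpTo M Q n τ → BoundsUpTo M Q k τ
  bounds-mono k≤n bounds p ip lp = bounds p ip (≤-trans lp k≤n)

  Psum-halts : ∀ {Psum} → PsumSpec M Psum → ∀ Q N τ → 1 ≤ N → BoundsUpTo M Q N τ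
             → Psum ∘ Q ∘ num N ⇓ᴹ qRep (haltSum M τ N)
  Psum-halts sS Q N τ 1≤N bounds = proj₂ (sS Q N _) (inj₂ (1≤N , τ , bounds , refl))

  -- πΩ halts on ρ once some partial halting sum with known bounds reaches ρ:
  -- its search stops at the least such index k ≤ N.
  πΩ-halts : ∀ {πΩ} → PiSpec M πΩ → ∀ Q ρ N τ → 1 ≤ N → BoundsUpTo M Q N τ
           → bitsVal ρ ℚ.≤ haltSum M τ N → Halts M (πΩ ∘ Q ∘ code ρ)
  πΩ-halts piS Q ρ N τ 1≤N bounds reached with bitsVal ρ ℚ.≟ 0ℚ
  ... | yes ρ≡0 = num 0 , proj₂ (piS Q ρ (num 0)) (inj₁ (ρ≡0 , refl))
  ... | no ρ≢0 with minimise (λ k → (1 ≤? k) ×-dec (bitsVal ρ ℚ.≤? haltSum M τ k)) N (1≤N , reached)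
  ...   | k , k≤N , (1≤k , reachedAtk) , notBefore =
          _ , proj₂ (piS Q ρ _) (inj₂ (ρ≢0 , k , 1≤k , τ , bounds-mono k≤N bounds , reachedAtk , below , refl))
    where
    below : ∀ n → 1 ≤ n → n < k → haltSum M τ n ℚ.< bitsVal ρ
    below n 1≤n n<k = ℚ.≰⇒> λ reachedAtn → notBefore n n<k (1≤n , reachedAtn)

  module SelfReferentialBound (T Psum πΩ PStar PSS : Bits)
    (tS : TSpec M T) (sS : PsumSpec M Psum) (piS : PiSpec M πΩ)
    (stS : PStarSpec M T Psum πΩ PStar) (ssS : PStarStarSpec M PStar PSS)
    (PT : Bits) (PT-total : Total M PT) where

    Q : Bits
    Q = PSS ∘ PT

    unfold : ∀ {w v} → PStar ∘ Q ∘ PT ∘ w ⇓ᴹ v → Q ∘ w ⇓ᴹ v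
    unfold {w} {v} = proj₂ (ssS PT w v)

    -- An input of πΩ has size ≥ 2, so the sizes ≤ |w| − 1 consulted are ≥ 1.
    πΩ-input-long : ∀ ρ → 2 ≤ length (πΩ ∘ Q ∘ code ρ)
    πΩ-input-long ρ = ≤-trans (s≤s (code-nonempty ρ)) (∘-length (πΩ ∘ Q) (code ρ))

    module OnπΩInput (ρ : Bits) (iw : inL (πΩ ∘ Q ∘ code ρ) ≡ true)
      (shorter : ∀ p → inL p ≡ true → length p < length (πΩ ∘ Q ∘ code ρ) → NumOut Q p) where

      w : Bits
      w = πΩ ∘ Q ∘ code ρ

      -- P*_T consults P_∑ on programs of size ≤ N = |w| − 1.
      N : ℕ
      N = length w ∸ 1

      1≤N : 1 ≤ N
      1≤N = ∸-monoˡ-≤ 1 (πΩ-input-long ρ)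

      bounded : Σ (Bits → ℕ) (BoundsUpTo M Q N)
      bounded = choose-bounds Q N λ p ip lp → shorter p ip (≤∸1⇒< (<⇒≤ (πΩ-input-long ρ)) lp)

      τ : Bits → ℕ
      τ = proj₁ bounded

      s : ℚ
      s = haltSum M τ N

      sum : Psum ∘ Q ∘ num N ⇓ᴹ qRep s
      sum = Psum-halts sS Q N τ 1≤N (proj₂ bounded)

      larger : bitsVal ρ ℚ.≤ s → ∀ t b → T ∘ w ⇓ᴹ num t → PT ∘ w ⇓ᴹ num b → NumOut Q w
      larger reached t b T⇓t PT⇓b with b <? t
      ... | yes b<t = t , unfold (proj₂ (stS Q PT w (num t))
              (inj₂ (ρ , refl , s , sum , inj₂ (reached , t , b , T⇓t , PT⇓b , inj₁ (b<t , refl)))))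
      ... | no b≮t  = b , unfold (proj₂ (stS Q PT w (num b))
              (inj₂ (ρ , refl , s , sum , inj₂ (reached , t , b , T⇓t , PT⇓b , inj₂ (≮⇒≥ b≮t , refl)))))

      output : NumOut Q w
      output with PT-total w iw | s ℚ.<? bitsVal ρ
      ... | b , PT⇓b | yes notReached = b , unfold (proj₂ (stS Q PT w (num b))
              (inj₂ (ρ , refl , s , sum , inj₁ (notReached , PT⇓b))))
      ... | b , PT⇓b | no notBelow
          with halts⇒steps (proj₂ (πΩ-halts piS Q ρ N τ 1≤N (proj₂ bounded) (ℚ.≮⇒≥ notBelow)))
      ...   | t , exactly = larger (ℚ.≮⇒≥ notBelow) t b (proj₂ (tS w (num t)) (t , exactly , refl)) PT⇓b

    step : ∀ w → inL w ≡ true → (∀ p → inL p ≡ true → length p < length w → NumOut Q p) → NumOut Q w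
    step w iw shorter with ∘code? (πΩ ∘ Q) w
    ... | yes (ρ , refl) = OnπΩInput.output ρ iw shorter
    ... | no notπΩInput  = let b , PT⇓b = PT-total w iw in
          b , unfold (proj₂ (stS Q PT w (num b)) (inj₁ (notπΩInput , PT⇓b)))

    outputs-below : ∀ n w → inL w ≡ true → length w < n → NumOut Q w
    outputs-below (suc n) w iw (s≤s |w|≤n) =
      step w iw λ p ip |p|<|w| → outputs-below n p ip (<-≤-trans |p|<|w| |w|≤n)

    Q-total : Total M Q
    Q-total w iw = outputs-below (suc (length w)) w iw ≤-refl

theorem10p1 : (M : Machine) → (T Psum πΩ PStar PStarStar : Bits)
    → TSpec M T → PsumSpec M Psum → PiSpec M πΩ
    → PStarSpec M T Psum πΩ PStar → PStarStarSpec M PStar PStarStar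
    → (PT : Bits) → Machine.inL M PT ≡ true → Total M PT
    → Total M (Machine._∘_ M PStarStar PT)
theorem10p1 M T Psum πΩ PStar PStarStar tS sS piS stS ssS PT _ PT-total =
  SelfReferentialBound.Q-total M T Psum πΩ PStar PStarStar tS sS piS stS ssS PT PT-total
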